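{- Let $M$ be a matroid such that for all cyclic flats $A,B$ of $M$, the pair $(A,B)$ is modular and $A\cup B$ is a cyclic flat of $M$. Then $M$ is configuration unique.
   Context: A cyclic flat is a flat that is a (possibly empty) union of circuits; the cyclic flats of $M$ form a lattice $\mathcal{Z}(M)$ under inclusion. A pair $(X,Y)$ is modular if $r(X)+r(Y)=r(X\cup Y)+r(X\cap Y)$. Matroids $M,N$ have the same configuration if $|E(M)|=|E(N)|$ and there is a lattice isomorphism $\Phi:\mathcal{Z}(M)\to\mathcal{Z}(N)$ with $|\Phi(F)|=|F|$ and $r_N(\Phi(F))=r_M(F)$ for all $F$; $M$ is configuration unique if every matroid with the same configuration as $M$ is isomorphic to $M$. -}

module Defs where

open import Data.Nat using (ℕ; _≤_; _<_; _+_)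
open import Data.Fin using (Fin)
open import Data.Fin.Subset using (Subset; _∈_; _∉_; _⊆_; _⊂_; _∪_; _∩_; ∣_∣; ⁅_⁆)
open import Data.Fin.Permutation using (Permutation′; _⟨$⟩ˡ_)
open import Data.Vec using (tabulate; lookup)
open import Data.Product using (Σ; ∃; _×_)
open import Relation.Binary.PropositionalEquality using (_≡_)

-- A matroid on the ground set E = Fin n, given by its rank function
-- (standard rank axioms R1–R3; non-negativity is automatic in ℕ).
record Matroid (n : ℕ) : Set where
  field
    r       : Subset n → ℕ
    r-bound : ∀ X → r X ≤ ∣ X ∣
    r-mono  : ∀ {X Y} → X ⊆ Y → r X ≤ r Y
    r-submod : ∀ X Y → r (X ∪ Y) + r (X ∩ Y) ≤ r X + r Y
open Matroid public

module _ {n : ℕ} (M : Matroid n) where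

  Independent : Subset n → Set
  Independent X = r M X ≡ ∣ X ∣

  Dependent : Subset n → Set
  Dependent X = r M X < ∣ X ∣

  IsCircuit : Subset n → Set
  IsCircuit C = Dependent C × (∀ D → D ⊂ C → Independent D)

  IsFlat : Subset n → Set
  IsFlat X = ∀ e → e ∉ X → r M X < r M (X ∪ ⁅ e ⁆)

  IsUnionOfCircuits : Subset n → Set
  IsUnionOfCircuits X = ∀ e → e ∈ X → ∃ λ C → IsCircuit C × C ⊆ X × e ∈ C

  IsCyclicFlat : Subset n → Set
  IsCyclicFlat X = IsFlat X × IsUnionOfCircuits X

  ModularPair : Subset n → Subset n → Set
  ModularPair X Y = r M X + r M Y ≡ r M (X ∪ Y) + r M (X ∩ Y)

-- Same configuration (both matroids on a ground set of size n):
-- an order isomorphism Φ (= lattice isomorphism) between the lattices of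
-- cyclic flats, preserving size and rank. Φ is given as a map on all
-- subsets, of which only its restriction to cyclic flats of M matters.
record IsConfigurationIso {n : ℕ} (M N : Matroid n) (Φ : Subset n → Subset n) : Set where
  field
    maps-to   : ∀ F → IsCyclicFlat M F → IsCyclicFlat N (Φ F)
    onto      : ∀ G → IsCyclicFlat N G → ∃ λ F → IsCyclicFlat M F × Φ F ≡ G
    monotone  : ∀ F F′ → IsCyclicFlat M F → IsCyclicFlat M F′ → F ⊆ F′ → Φ F ⊆ Φ F′
    reflects  : ∀ F F′ → IsCyclicFlat M F → IsCyclicFlat M F′ → Φ F ⊆ Φ F′ → F ⊆ F′
    size      : ∀ F → IsCyclicFlat M F → ∣ Φ F ∣ ≡ ∣ F ∣
    rank      : ∀ F → IsCyclicFlat M F → r N (Φ F) ≡ r M F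

SameConfiguration : {n : ℕ} → Matroid n → Matroid n → Set
SameConfiguration M N = ∃ λ Φ → IsConfigurationIso M N Φ

image : {n : ℕ} → Permutation′ n → Subset n → Subset n
image σ X = tabulate λ j → lookup X (σ ⟨$⟩ˡ j)

Isomorphic : {n : ℕ} → Matroid n → Matroid n → Set
Isomorphic {n} M N = Σ (Permutation′ n) λ σ → ∀ X → r N (image σ X) ≡ r M X

ConfigurationUnique : {n : ℕ} → Matroid n → Set
ConfigurationUnique {n} M = (N : Matroid n) → SameConfiguration M N → Isomorphic M N

{-# OPTIONS --safe #-}
-- For cyclic flats A and B, monotonicity of Φ gives ΦA ∪ ΦB ⊆ Φ(A ∪ B). The cyclic core of
-- ΦA ∩ ΦB is ΦD for a cyclic flat D ⊆ A ∩ B, and modularity of (A, B) then forces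
-- ∣ΦA ∩ ΦB∣ ≤ ∣A ∩ B∣; comparing sizes, Φ(A ∪ B) = ΦA ∪ ΦB. By inclusion–exclusion Φ preserves
-- the size of every intersection of cyclic flats, hence of every atom of the Boolean algebra
-- they generate, and matching atoms of equal size gives a permutation σ of the ground set with
-- Φ F = σ F for all cyclic flats F. As r X = min { r F + ∣X ─ F∣ : F cyclic flat }, σ is an
-- isomorphism.

module Submission where

open import Defs
open import Algebra.Bundles using (CommutativeMonoid)
import Algebra.Properties.CommutativeSemigroup as CommutativeSemigroupProperties
import Data.Bool as Bool
open import Data.Bool using (if_then_else_; _∧_; not)
open import Data.Bool.Properties using (∧-zeroʳ; ∧-identityʳ)
open import Data.Fin using (Fin; zero; suc; _≟_)
open import Data.Fin.Permutation using (Permutation′; _⟨$⟩ʳ_; _⟨$⟩ˡ_; _∘ₚ_; transpose; lift₀; flip)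
import Data.Fin.Permutation as Perm
open import Data.Fin.Properties using (any?)
open import Data.Fin.Subset
open import Data.Fin.Subset.Properties
open import Data.Fin.Subset.Induction using (⊂-wellFounded; ⊃-wellFounded; Acc; acc)
open import Data.Nat using (ℕ; zero; suc; _+_; _≤_; _<_; _≤?_; _^_; z≤n; s≤s; s≤s⁻¹)
open import Data.Nat.Properties hiding (_≟_)
open import Data.Product using (Σ; ∃; _×_; _,_; proj₁; proj₂; uncurry)
open import Data.Sum using (inj₁; inj₂; [_,_])
open import Data.Vec using (Vec; []; _∷_; here; there; map; toList; allPairs; tabulate; lookup)
open import Data.Vec.Membership.Propositional using () renaming (_∈_ to _∈ᵥ_)
open import Data.Vec.Membership.Propositional.Properties using (∈-map⁺; ∈-allPairs⁺)
open import Data.Vec.Properties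
  using (tabulate-cong; tabulate∘lookup; lookup∘tabulate; lookup-zipWith; lookup-map; lookup-replicate;
         []=⇒lookup; ≡-dec; ∷-injectiveˡ; ∷-injectiveʳ; map-∘)
import Data.Vec.Relation.Unary.All as All
open import Data.Vec.Relation.Unary.All using (All; []; _∷_)
open import Data.Vec.Relation.Unary.All.Properties using (map⁺)
import Data.Vec.Relation.Unary.Any as Any
open import Function using (_∘_; id)
open import Level using (Level)
open import Relation.Binary.Definitions using (DecidableEquality)
open import Relation.Binary.PropositionalEquality hiding ([_])
open import Relation.Nullary using (yes; no; does; ¬?; _×-dec_; contradiction)
open import Relation.Nullary.Decidable using (dec-true)

open import Algebra.Properties.CommutativeMonoid.Sum +-0-commutativeMonoid using (sum; sum-permute)

private
  variable
    ℓ ℓ′ : Level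
    V : Set ℓ
    W : Set ℓ′
    n k m : ℕ
    p q : Subset n
    x : Fin n

-- Subsets

p⊆q∪p─q : ∀ (q : Subset n) → p ⊆ q ∪ (p ─ q)
p⊆q∪p─q q {x} x∈p with x ∈? q
... | yes x∈q = x∈p∪q⁺ (inj₁ x∈q)
... | no  x∉q = x∈p∪q⁺ (inj₂ (x∈p∧x∉q⇒x∈p─q x∈p x∉q))

x∈p⇒⁅x⁆⊆p : x ∈ p → ⁅ x ⁆ ⊆ p
x∈p⇒⁅x⁆⊆p {x = x} {p = p} x∈p y∈⁅x⁆ = subst (_∈ p) (sym (x∈⁅y⁆⇒x≡y x y∈⁅x⁆)) x∈p

x∈p─q⇒x∉q : ∀ (p q : Subset n) → x ∈ p ─ q → x ∉ q
x∈p─q⇒x∉q (_ ∷ p) (outside ∷ q) here        ()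
x∈p─q⇒x∉q (_ ∷ p) (_       ∷ q) (there x∈) (there x∈q) = x∈p─q⇒x∉q p q x∈ x∈q

x∈p-y⇒x≢y : ∀ {y} → x ∈ p - y → x ≢ y
x∈p-y⇒x≢y {p = p} {y = y} x∈p-y = x∉⁅y⁆⇒x≢y (x∈p─q⇒x∉q p ⁅ y ⁆ x∈p-y)

─-monoˡ-⊆ : ∀ {r : Subset n} → p ⊆ q → p ─ r ⊆ q ─ r
─-monoˡ-⊆ {p = p} {r = r} p⊆q x∈p─r = x∈p∧x∉q⇒x∈p─q (p⊆q (p─q⊆p p r x∈p─r)) (x∈p─q⇒x∉q p r x∈p─r)

─-antimonoʳ-⊆ : ∀ {r : Subset n} → q ⊆ r → p ─ r ⊆ p ─ q
─-antimonoʳ-⊆ {p = p} {r = r} q⊆r x∈p─r = x∈p∧x∉q⇒x∈p─q (p─q⊆p p r x∈p─r) (x∈p─q⇒x∉q p r x∈p─r ∘ q⊆r)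

p─q≡p∩∁q : ∀ (p q : Subset n) → p ─ q ≡ p ∩ ∁ q
p─q≡p∩∁q []      []            = refl
p─q≡p∩∁q (s ∷ p) (inside  ∷ q) = cong₂ _∷_ (sym (∧-zeroʳ s)) (p─q≡p∩∁q p q)
p─q≡p∩∁q (s ∷ p) (outside ∷ q) = cong₂ _∷_ (sym (∧-identityʳ s)) (p─q≡p∩∁q p q)

lookup-─ : ∀ (p q : Subset n) i → lookup (p ─ q) i ≡ lookup p i ∧ not (lookup q i)
lookup-─ p q i = begin
  lookup (p ─ q) i                    ≡⟨ cong (λ s → lookup s i) (p─q≡p∩∁q p q) ⟩
  lookup (p ∩ ∁ q) i                  ≡⟨ lookup-zipWith _∧_ i p (∁ q) ⟩
  lookup p i ∧ lookup (∁ q) i         ≡⟨ cong (lookup p i ∧_) (lookup-map i not q) ⟩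
  lookup p i ∧ not (lookup q i)       ∎
  where open ≡-Reasoning

∣p∩q∣+∣p∩∁q∣≡∣p∣ : ∀ (p q : Subset n) → ∣ p ∩ q ∣ + ∣ p ∩ ∁ q ∣ ≡ ∣ p ∣
∣p∩q∣+∣p∩∁q∣≡∣p∣ []            []            = refl
∣p∩q∣+∣p∩∁q∣≡∣p∣ (inside  ∷ p) (inside  ∷ q) = cong suc (∣p∩q∣+∣p∩∁q∣≡∣p∣ p q)
∣p∩q∣+∣p∩∁q∣≡∣p∣ (inside  ∷ p) (outside ∷ q) = trans (+-suc _ _) (cong suc (∣p∩q∣+∣p∩∁q∣≡∣p∣ p q))
∣p∩q∣+∣p∩∁q∣≡∣p∣ (outside ∷ p) (_       ∷ q) = ∣p∩q∣+∣p∩∁q∣≡∣p∣ p q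

q⊆p⇒∣q∣+∣p─q∣≡∣p∣ : q ⊆ p → ∣ q ∣ + ∣ p ─ q ∣ ≡ ∣ p ∣
q⊆p⇒∣q∣+∣p─q∣≡∣p∣ {q = q} {p = p} q⊆p = begin
  ∣ q ∣ + ∣ p ─ q ∣         ≡⟨ cong₂ (λ a b → ∣ a ∣ + ∣ b ∣) (sym p∩q≡q) (p─q≡p∩∁q p q) ⟩
  ∣ p ∩ q ∣ + ∣ p ∩ ∁ q ∣   ≡⟨ ∣p∩q∣+∣p∩∁q∣≡∣p∣ p q ⟩
  ∣ p ∣                     ∎
  where
  open ≡-Reasoning
  p∩q≡q : p ∩ q ≡ q
  p∩q≡q = ⊆-antisym (p∩q⊆q p q) (λ x∈q → x∈p∩q⁺ (q⊆p x∈q , x∈q))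

∣p─p∣≡0 : ∀ (p : Subset n) → ∣ p ─ p ∣ ≡ 0
∣p─p∣≡0 {n} p = trans (cong ∣_∣ (trans (p─q≡p∩∁q p p) (∩-inverseʳ p))) (∣⊥∣≡0 n)

∣p∪q∣+∣p∩q∣≡∣p∣+∣q∣ : ∀ (p q : Subset n) → ∣ p ∪ q ∣ + ∣ p ∩ q ∣ ≡ ∣ p ∣ + ∣ q ∣
∣p∪q∣+∣p∩q∣≡∣p∣+∣q∣ []            []            = refl
∣p∪q∣+∣p∩q∣≡∣p∣+∣q∣ (inside  ∷ p) (inside  ∷ q) =
  cong suc (trans (+-suc _ _) (trans (cong suc (∣p∪q∣+∣p∩q∣≡∣p∣+∣q∣ p q)) (sym (+-suc _ _))))
∣p∪q∣+∣p∩q∣≡∣p∣+∣q∣ (inside  ∷ p) (outside ∷ q) = cong suc (∣p∪q∣+∣p∩q∣≡∣p∣+∣q∣ p q)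
∣p∪q∣+∣p∩q∣≡∣p∣+∣q∣ (outside ∷ p) (inside  ∷ q) = trans (cong suc (∣p∪q∣+∣p∩q∣≡∣p∣+∣q∣ p q)) (sym (+-suc _ _))
∣p∪q∣+∣p∩q∣≡∣p∣+∣q∣ (outside ∷ p) (outside ∷ q) = ∣p∪q∣+∣p∩q∣≡∣p∣+∣q∣ p q

∣∩∣-determined : ∀ {p q p′ q′ : Subset n} → ∣ p ∣ ≡ ∣ p′ ∣ → ∣ q ∣ ≡ ∣ q′ ∣ → ∣ p ∪ q ∣ ≡ ∣ p′ ∪ q′ ∣ →
                 ∣ p ∩ q ∣ ≡ ∣ p′ ∩ q′ ∣
∣∩∣-determined {p = p} {q} {p′} {q′} ∣p∣≡ ∣q∣≡ ∣p∪q∣≡ = +-cancelˡ-≡ ∣ p ∪ q ∣ _ _ (begin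
  ∣ p ∪ q ∣ + ∣ p ∩ q ∣        ≡⟨ ∣p∪q∣+∣p∩q∣≡∣p∣+∣q∣ p q ⟩
  ∣ p ∣ + ∣ q ∣                ≡⟨ cong₂ _+_ ∣p∣≡ ∣q∣≡ ⟩
  ∣ p′ ∣ + ∣ q′ ∣              ≡⟨ ∣p∪q∣+∣p∩q∣≡∣p∣+∣q∣ p′ q′ ⟨
  ∣ p′ ∪ q′ ∣ + ∣ p′ ∩ q′ ∣    ≡⟨ cong (_+ ∣ p′ ∩ q′ ∣) ∣p∪q∣≡ ⟨
  ∣ p ∪ q ∣ + ∣ p′ ∩ q′ ∣      ∎)
  where open ≡-Reasoning

x∈p⇒∣p∣≡1+∣p-x∣ : x ∈ p → ∣ p ∣ ≡ suc ∣ p - x ∣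
x∈p⇒∣p∣≡1+∣p-x∣ {p = inside  ∷ p} here        = cong suc (cong ∣_∣ (sym (p─⊥≡p p)))
x∈p⇒∣p∣≡1+∣p-x∣ {p = inside  ∷ p} (there x∈p) = cong suc (x∈p⇒∣p∣≡1+∣p-x∣ x∈p)
x∈p⇒∣p∣≡1+∣p-x∣ {p = outside ∷ p} (there x∈p) = x∈p⇒∣p∣≡1+∣p-x∣ x∈p

x∈p∧x∉q⇒∣p─q∣≡1+∣p-x─q∣ : x ∈ p → x ∉ q → ∣ p ─ q ∣ ≡ suc ∣ p - x ─ q ∣
x∈p∧x∉q⇒∣p─q∣≡1+∣p-x─q∣ {x = x} {p = p} {q = q} x∈p x∉q = begin
  ∣ p ─ q ∣             ≡⟨ x∈p⇒∣p∣≡1+∣p-x∣ (x∈p∧x∉q⇒x∈p─q x∈p x∉q) ⟩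
  suc ∣ p ─ q - x ∣     ≡⟨ cong (suc ∘ ∣_∣) (p─q─r≡p─r─q p q ⁅ x ⁆) ⟩
  suc ∣ p - x ─ q ∣     ∎
  where open ≡-Reasoning

∣s∷p∣≡∣s∷q∣⇒∣p∣≡∣q∣ : ∀ s (p q : Subset n) → ∣ s ∷ p ∣ ≡ ∣ s ∷ q ∣ → ∣ p ∣ ≡ ∣ q ∣
∣s∷p∣≡∣s∷q∣⇒∣p∣≡∣q∣ inside  p q eq = suc-injective eq
∣s∷p∣≡∣s∷q∣⇒∣p∣≡∣q∣ outside p q eq = eq

p⊆q⇒∣q∣≤∣p∣⇒p≡q : p ⊆ q → ∣ q ∣ ≤ ∣ p ∣ → p ≡ q
p⊆q⇒∣q∣≤∣p∣⇒p≡q {p = p} {q = q} p⊆q ∣q∣≤∣p∣ = ⊆-antisym p⊆q q⊆p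
  where
  q⊆p : q ⊆ p
  q⊆p {x} x∈q with x ∈? p
  ... | yes x∈p = x∈p
  ... | no  x∉p = contradiction ∣q∣≤∣p∣ (<⇒≱ (p⊂q⇒∣p∣<∣q∣ (p⊆q , x , x∈q , x∉p)))

p∪⋂qs≡⋂[p∪qs] : ∀ (p : Subset n) (qs : Vec (Subset n) k) → p ∪ ⋂ (toList qs) ≡ ⋂ (toList (map (p ∪_) qs))
p∪⋂qs≡⋂[p∪qs] p []       = ∪-zeroʳ p
p∪⋂qs≡⋂[p∪qs] p (q ∷ qs) = trans (∪-distribˡ-∩ p q _) (cong ((p ∪ q) ∩_) (p∪⋂qs≡⋂[p∪qs] p qs))

allSubsets : ∀ n → Vec (Subset n) (2 ^ n)
allSubsets zero    = [] ∷ []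
allSubsets (suc n) = map (uncurry _∷_) (allPairs (inside ∷ outside ∷ []) (allSubsets n))

∈-allSubsets : ∀ (p : Subset n) → p ∈ᵥ allSubsets n
∈-allSubsets []      = Any.here refl
∈-allSubsets (s ∷ p) = ∈-map⁺ (uncurry _∷_) (∈-allPairs⁺ (s∈sides s) (∈-allSubsets p))
  where
  s∈sides : ∀ s → s ∈ᵥ inside ∷ outside ∷ []
  s∈sides inside  = Any.here refl
  s∈sides outside = Any.there (Any.here refl)

map-cong⁻ : ∀ {f g : V → W} {xs : Vec V k} {v} → map f xs ≡ map g xs → v ∈ᵥ xs → f v ≡ g v
map-cong⁻ eq (Any.here refl) = ∷-injectiveˡ eq
map-cong⁻ eq (Any.there v∈) = map-cong⁻ (∷-injectiveʳ eq) v∈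

-- Permutations and fibres

∣tabulate∣≡sum : (f : Fin n → Side) → ∣ tabulate f ∣ ≡ sum (λ i → if f i then 1 else 0)
∣tabulate∣≡sum {zero}  f = refl
∣tabulate∣≡sum {suc n} f with f zero
... | inside  = cong suc (∣tabulate∣≡sum (f ∘ suc))
... | outside = ∣tabulate∣≡sum (f ∘ suc)

∣tabulate∘π∣≡∣tabulate∣ : (f : Fin n → Side) (π : Permutation′ n) → ∣ tabulate (f ∘ (π ⟨$⟩ʳ_)) ∣ ≡ ∣ tabulate f ∣
∣tabulate∘π∣≡∣tabulate∣ f π = begin
  ∣ tabulate (f ∘ (π ⟨$⟩ʳ_)) ∣                    ≡⟨ ∣tabulate∣≡sum (f ∘ (π ⟨$⟩ʳ_)) ⟩
  sum (λ i → if f (π ⟨$⟩ʳ i) then 1 else 0)       ≡⟨ sum-permute (λ i → if f i then 1 else 0) π ⟨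
  sum (λ i → if f i then 1 else 0)                ≡⟨ ∣tabulate∣≡sum f ⟨
  ∣ tabulate f ∣                                  ∎
  where open ≡-Reasoning

∣image∣≡∣p∣ : ∀ (σ : Permutation′ n) p → ∣ image σ p ∣ ≡ ∣ p ∣
∣image∣≡∣p∣ σ p = trans (∣tabulate∘π∣≡∣tabulate∣ (lookup p) (flip σ)) (cong ∣_∣ (tabulate∘lookup p))

image-─ : ∀ (σ : Permutation′ n) X Y → image σ (X ─ Y) ≡ image σ X ─ image σ Y
image-─ σ X Y = trans (tabulate-cong pointwise) (tabulate∘lookup _)
  where
  open ≡-Reasoning
  pointwise : ∀ j → lookup (X ─ Y) (σ ⟨$⟩ˡ j) ≡ lookup (image σ X ─ image σ Y) j
  pointwise j = begin
    lookup (X ─ Y) (σ ⟨$⟩ˡ j)                           ≡⟨ lookup-─ X Y (σ ⟨$⟩ˡ j) ⟩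
    lookup X (σ ⟨$⟩ˡ j) ∧ not (lookup Y (σ ⟨$⟩ˡ j))
      ≡⟨ cong₂ (λ a b → a ∧ not b) (lookup∘tabulate _ j) (lookup∘tabulate _ j) ⟨
    lookup (image σ X) j ∧ not (lookup (image σ Y) j)   ≡⟨ lookup-─ (image σ X) (image σ Y) j ⟨
    lookup (image σ X ─ image σ Y) j                    ∎

module _ (_≟_ : DecidableEquality V) where

  fibre : (Fin n → V) → V → Subset n
  fibre t a = tabulate (λ i → does (t i ≟ a))

  ∈fibre⇒≡ : (t : Fin n → V) (a : V) {i : Fin n} → i ∈ fibre t a → t i ≡ a
  ∈fibre⇒≡ t a {i} i∈fibre with t i ≟ a | trans (sym (lookup∘tabulate _ i)) ([]=⇒lookup i∈fibre)
  ... | yes tᵢ≡a | _  = tᵢ≡a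
  ... | no  _    | ()

  0<∣fibre∣⇒preimage : ∀ {n} (t : Fin n → V) (a : V) → 0 < ∣ fibre t a ∣ → Σ (Fin n) λ i → t i ≡ a
  0<∣fibre∣⇒preimage {n} t a 0<∣fibre∣ with nonempty? (fibre t a)
  ... | yes (i , i∈fibre) = i , ∈fibre⇒≡ t a i∈fibre
  ... | no  empty         = contradiction (trans (cong ∣_∣ (Empty-unique empty)) (∣⊥∣≡0 n)) (>⇒≢ 0<∣fibre∣)

  equinumerous-fibres⇒permutation : ∀ {n} (t u : Fin n → V) → (∀ a → ∣ fibre t a ∣ ≡ ∣ fibre u a ∣) →
                                    Σ (Permutation′ n) λ π → ∀ i → u (π ⟨$⟩ʳ i) ≡ t i
  -- Send 0 to some j with u j ≡ t 0, moved to the front by a transposition, and recurse on the tails.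
  equinumerous-fibres⇒permutation {zero}  t u _    = Perm.id , λ ()
  equinumerous-fibres⇒permutation {suc n} t u same = lift₀ π₀ ∘ₚ ρ , matches
    where
    open ≡-Reasoning
    t₀ = t zero

    0<∣fibre-t₀∣ : 0 < ∣ fibre t t₀ ∣
    0<∣fibre-t₀∣ = subst (λ s → 0 < ∣ s ∷ fibre (t ∘ suc) t₀ ∣) (sym (dec-true (t₀ ≟ t₀) refl)) (s≤s z≤n)

    preimage : Σ (Fin (suc n)) λ j → u j ≡ t₀
    preimage = 0<∣fibre∣⇒preimage u t₀ (subst (0 <_) (same t₀) 0<∣fibre-t₀∣)
    j = proj₁ preimage
    uⱼ≡t₀ = proj₂ preimage

    ρ = transpose zero j
    u′ = u ∘ (ρ ⟨$⟩ʳ_)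

    same′ : ∀ a → ∣ fibre (t ∘ suc) a ∣ ≡ ∣ fibre (u′ ∘ suc) a ∣
    same′ a = ∣s∷p∣≡∣s∷q∣⇒∣p∣≡∣q∣ (does (t₀ ≟ a)) (fibre (t ∘ suc) a) (fibre (u′ ∘ suc) a) (begin
      ∣ fibre t a ∣                                ≡⟨ same a ⟩
      ∣ fibre u a ∣                                ≡⟨ ∣tabulate∘π∣≡∣tabulate∣ (λ i → does (u i ≟ a)) ρ ⟨
      ∣ fibre u′ a ∣                               ≡⟨ cong (λ b → ∣ does (b ≟ a) ∷ fibre (u′ ∘ suc) a ∣) uⱼ≡t₀ ⟩
      ∣ does (t₀ ≟ a) ∷ fibre (u′ ∘ suc) a ∣       ∎)

    tails : Σ (Permutation′ n) λ π → ∀ i → u′ (suc (π ⟨$⟩ʳ i)) ≡ t (suc i)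
    tails = equinumerous-fibres⇒permutation (t ∘ suc) (u′ ∘ suc) same′
    π₀ = proj₁ tails

    matches : ∀ i → u ((lift₀ π₀ ∘ₚ ρ) ⟨$⟩ʳ i) ≡ t i
    matches zero    = uⱼ≡t₀
    matches (suc i) = proj₂ tails i

literal : Side → Subset n → Subset n
literal inside  p = p
literal outside p = ∁ p

atom : Vec (Subset n) k → Subset k → Subset n
atom []       []      = ⊤
atom (p ∷ ps) (s ∷ τ) = literal s p ∩ atom ps τ

profile : Vec (Subset n) k → Fin n → Subset k
profile ps x = map (λ p → lookup p x) ps

_≟ˢ_ : DecidableEquality (Subset k)
_≟ˢ_ = ≡-dec Bool._≟_

lookup-literal : ∀ s (p : Subset n) x → lookup (literal s p) x ≡ does (lookup p x Bool.≟ s)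
lookup-literal inside  p x = b≡does[b≟inside] (lookup p x)
  where
  b≡does[b≟inside] : ∀ b → b ≡ does (b Bool.≟ inside)
  b≡does[b≟inside] inside  = refl
  b≡does[b≟inside] outside = refl
lookup-literal outside p x = trans (lookup-map x not p) (not-b≡does[b≟outside] (lookup p x))
  where
  not-b≡does[b≟outside] : ∀ b → not b ≡ does (b Bool.≟ outside)
  not-b≡does[b≟outside] inside  = refl
  not-b≡does[b≟outside] outside = refl

lookup-atom : ∀ (ps : Vec (Subset n) k) τ x → lookup (atom ps τ) x ≡ does (profile ps x ≟ˢ τ)
lookup-atom []       []      x = lookup-replicate x inside
lookup-atom (p ∷ ps) (s ∷ τ) x =
  trans (lookup-zipWith _∧_ x (literal s p) (atom ps τ)) (cong₂ _∧_ (lookup-literal s p x) (lookup-atom ps τ x))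

atom≡fibre : ∀ (ps : Vec (Subset n) k) τ → atom ps τ ≡ fibre _≟ˢ_ (profile ps) τ
atom≡fibre ps τ = trans (sym (tabulate∘lookup (atom ps τ))) (tabulate-cong (lookup-atom ps τ))

-- Matroids

_⊆cl[_]_ : Subset n → Matroid n → Subset n → Set
G ⊆cl[ M ] X = r M (X ∪ G) ≤ r M X

NoColoops : Matroid n → Subset n → Set
NoColoops M X = ∀ {e} → e ∈ X → r M X ≤ r M (X - e)

-- Witnesses the rank formula r X = min { r F + ∣ X ─ F ∣ : F cyclic flat }.
record CyclicCore (M : Matroid n) (X : Subset n) : Set where
  field
    core         : Subset n
    isCyclicFlat : IsCyclicFlat M core
    rank-bound   : r M core + ∣ X ─ core ∣ ≤ r M X
    spanned      : core ⊆cl[ M ] X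

open CyclicCore public

module _ {n : ℕ} (M : Matroid n) where

  private
    variable
      C F G X Y : Subset n
      e : Fin n

  r[X∪Y]≤r[X]+∣Y∣ : ∀ X Y → r M (X ∪ Y) ≤ r M X + ∣ Y ∣
  r[X∪Y]≤r[X]+∣Y∣ X Y = ≤-trans (m≤m+n _ _) (≤-trans (r-submod M X Y) (+-monoʳ-≤ (r M X) (r-bound M Y)))

  r[X]≤r[Y]+∣X─Y∣ : ∀ X Y → r M X ≤ r M Y + ∣ X ─ Y ∣
  r[X]≤r[Y]+∣X─Y∣ X Y = ≤-trans (r-mono M (p⊆q∪p─q Y)) (r[X∪Y]≤r[X]+∣Y∣ Y (X ─ Y))

  ⊆cl-monoʳ : Y ⊆ X → G ⊆cl[ M ] Y → G ⊆cl[ M ] X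
  ⊆cl-monoʳ {Y} {X} {G} Y⊆X G⊆clY = +-cancelʳ-≤ (r M Y) _ _ (begin
    r M (X ∪ G) + r M Y                              ≤⟨ +-mono-≤ (r-mono M X∪G⊆) (r-mono M Y⊆) ⟩
    r M (X ∪ (Y ∪ G)) + r M (X ∩ (Y ∪ G))            ≤⟨ r-submod M X (Y ∪ G) ⟩
    r M X + r M (Y ∪ G)                              ≤⟨ +-monoʳ-≤ (r M X) G⊆clY ⟩
    r M X + r M Y                                    ∎)
    where
    open ≤-Reasoning
    X∪G⊆ : X ∪ G ⊆ X ∪ (Y ∪ G)
    X∪G⊆ x∈ = [ p⊆p∪q _ , q⊆p∪q X _ ∘ q⊆p∪q Y G ] (x∈p∪q⁻ X G x∈)
    Y⊆ : Y ⊆ X ∩ (Y ∪ G)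
    Y⊆ x∈Y = x∈p∩q⁺ (Y⊆X x∈Y , p⊆p∪q G x∈Y)

  flat-⊆cl⇒⊆ : IsFlat M X → G ⊆cl[ M ] X → G ⊆ X
  flat-⊆cl⇒⊆ {X} {G} flat G⊆clX {e} e∈G with e ∈? X
  ... | yes e∈X = e∈X
  ... | no  e∉X = contradiction (≤-trans (flat e e∉X) (≤-trans (r-mono M X∪⁅e⁆⊆X∪G) G⊆clX)) (<-irrefl refl)
    where
    X∪⁅e⁆⊆X∪G : X ∪ ⁅ e ⁆ ⊆ X ∪ G
    X∪⁅e⁆⊆X∪G x∈ = [ p⊆p∪q G , q⊆p∪q X G ∘ x∈p⇒⁅x⁆⊆p e∈G ] (x∈p∪q⁻ X ⁅ e ⁆ x∈)

  nonColoop-⊇ : Y ⊆ X → e ∈ Y → r M Y ≤ r M (Y - e) → r M X ≤ r M (X - e)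
  nonColoop-⊇ {Y} {X} {e} Y⊆X e∈Y e∈clY-e = +-cancelʳ-≤ (r M (Y - e)) _ _ (begin
    r M X + r M (Y - e)                              ≤⟨ +-mono-≤ (r-mono M X⊆) (r-mono M Y-e⊆) ⟩
    r M ((X - e) ∪ Y) + r M ((X - e) ∩ Y)            ≤⟨ r-submod M (X - e) Y ⟩
    r M (X - e) + r M Y                              ≤⟨ +-monoʳ-≤ (r M (X - e)) e∈clY-e ⟩
    r M (X - e) + r M (Y - e)                        ∎)
    where
    open ≤-Reasoning
    X⊆ : X ⊆ (X - e) ∪ Y
    X⊆ {x} x∈X with x ≟ e
    ... | yes refl = q⊆p∪q (X - e) Y e∈Y
    ... | no  x≢e  = p⊆p∪q Y (x∈p∧x≢y⇒x∈p-y x∈X x≢e)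
    Y-e⊆ : Y - e ⊆ (X - e) ∩ Y
    Y-e⊆ x∈ = x∈p∩q⁺ (─-monoˡ-⊆ Y⊆X x∈ , p─q⊆p Y ⁅ e ⁆ x∈)

  coloop-⊆ : Y ⊆ X → e ∈ Y → r M (X - e) < r M X → r M (Y - e) < r M Y
  coloop-⊆ Y⊆X e∈Y coloop = ≰⇒> (<⇒≱ coloop ∘ nonColoop-⊇ Y⊆X e∈Y)

  independent-⊆ : Y ⊆ X → Independent M X → Independent M Y
  independent-⊆ {Y} {X} Y⊆X indepX = ≤-antisym (r-bound M Y) (+-cancelʳ-≤ ∣ X ─ Y ∣ _ _ (begin
    ∣ Y ∣ + ∣ X ─ Y ∣     ≡⟨ q⊆p⇒∣q∣+∣p─q∣≡∣p∣ Y⊆X ⟩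
    ∣ X ∣                 ≡⟨ indepX ⟨
    r M X                 ≤⟨ r[X]≤r[Y]+∣X─Y∣ X Y ⟩
    r M Y + ∣ X ─ Y ∣     ∎))
    where open ≤-Reasoning

  coloops⇒independent : (∀ {e} → e ∈ X → r M (X - e) < r M X) → Independent M X
  coloops⇒independent {X} = go X (⊂-wellFounded X)
    where
    go : ∀ X → Acc _⊂_ X → (∀ {e} → e ∈ X → r M (X - e) < r M X) → Independent M X
    go X (acc rs) coloops with nonempty? X
    ... | no  empty = ≤-antisym (r-bound M X) (subst (_≤ r M X) (sym ∣X∣≡0) z≤n)
      where ∣X∣≡0 = trans (cong ∣_∣ (Empty-unique empty)) (∣⊥∣≡0 n)
    ... | yes (e , e∈X) = ≤-antisym (r-bound M X) (begin
      ∣ X ∣                 ≡⟨ x∈p⇒∣p∣≡1+∣p-x∣ e∈X ⟩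
      suc ∣ X - e ∣         ≡⟨ cong suc (go (X - e) (rs (x∈p⇒p-x⊂p e∈X)) coloops′) ⟨
      suc (r M (X - e))     ≤⟨ coloops e∈X ⟩
      r M X                 ∎)
      where
      open ≤-Reasoning
      coloops′ : ∀ {f} → f ∈ X - e → r M (X - e - f) < r M (X - e)
      coloops′ f∈X-e = coloop-⊆ (p─q⊆p X ⁅ e ⁆) f∈X-e (coloops (p─q⊆p X ⁅ e ⁆ f∈X-e))

  circuit⇒noColoops : IsCircuit M C → NoColoops M C
  circuit⇒noColoops {C} (dependent , minimal) {e} e∈C = begin
    r M C              ≤⟨ s≤s⁻¹ (subst (r M C <_) (x∈p⇒∣p∣≡1+∣p-x∣ e∈C) dependent) ⟩
    ∣ C - e ∣          ≡⟨ minimal (C - e) (x∈p⇒p-x⊂p e∈C) ⟨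
    r M (C - e)        ∎
    where open ≤-Reasoning

  unionOfCircuits⇒noColoops : IsUnionOfCircuits M X → NoColoops M X
  unionOfCircuits⇒noColoops unionOfCircuits e∈X with unionOfCircuits _ e∈X
  ... | C , circuit , C⊆X , e∈C = nonColoop-⊇ C⊆X e∈C (circuit⇒noColoops circuit e∈C)

  ∪-unionOfCircuits : IsUnionOfCircuits M X → IsUnionOfCircuits M Y → IsUnionOfCircuits M (X ∪ Y)
  ∪-unionOfCircuits {X} {Y} ucX ucY e e∈X∪Y with x∈p∪q⁻ X Y e∈X∪Y
  ... | inj₁ e∈X = let C , circuit , C⊆X , e∈C = ucX e e∈X in C , circuit , p⊆p∪q Y ∘ C⊆X , e∈C
  ... | inj₂ e∈Y = let C , circuit , C⊆Y , e∈C = ucY e e∈Y in C , circuit , q⊆p∪q X Y ∘ C⊆Y , e∈C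

  minimal-nonColoop⇒circuit : e ∈ Y → r M Y ≤ r M (Y - e) →
                              (∀ {f} → f ∈ Y → f ≢ e → r M (Y - f - e) < r M (Y - f)) → IsCircuit M Y
  minimal-nonColoop⇒circuit {e} {Y} e∈Y e∈clY-e minimal = dependent , proper⇒independent
    where
    Y-e-independent : Independent M (Y - e)
    Y-e-independent = coloops⇒independent λ {f} f∈Y-e → begin-strict
      r M (Y - e - f)    ≡⟨ cong (r M) (p─x─y≡p─y─x Y e f) ⟩
      r M (Y - f - e)    <⟨ minimal (p─q⊆p Y ⁅ e ⁆ f∈Y-e) (x∈p-y⇒x≢y f∈Y-e) ⟩
      r M (Y - f)        ≤⟨ r-mono M (p─q⊆p Y ⁅ f ⁆) ⟩
      r M Y              ≤⟨ e∈clY-e ⟩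
      r M (Y - e)        ∎
      where open ≤-Reasoning

    dependent : Dependent M Y
    dependent = ≤-<-trans e∈clY-e (≤-<-trans (r-bound M (Y - e)) (x∈p⇒∣p-x∣<∣p∣ e∈Y))

    Y-x-independent : ∀ {x} → x ∈ Y → Independent M (Y - x)
    Y-x-independent {x} x∈Y with x ≟ e
    ... | yes refl = Y-e-independent
    ... | no  x≢e  = ≤-antisym (r-bound M (Y - x)) (begin
      ∣ Y - x ∣            ≡⟨ x∈p⇒∣p∣≡1+∣p-x∣ (x∈p∧x≢y⇒x∈p-y e∈Y (x≢e ∘ sym)) ⟩
      suc ∣ Y - x - e ∣    ≡⟨ cong suc (independent-⊆ (─-monoˡ-⊆ (p─q⊆p Y ⁅ x ⁆)) Y-e-independent) ⟨
      suc (r M (Y - x - e)) ≤⟨ minimal x∈Y x≢e ⟩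
      r M (Y - x)          ∎)
      where open ≤-Reasoning

    proper⇒independent : ∀ D → D ⊂ Y → Independent M D
    proper⇒independent D (D⊆Y , x , x∈Y , x∉D) = independent-⊆ D⊆Y-x (Y-x-independent x∈Y)
      where
      D⊆Y-x : D ⊆ Y - x
      D⊆Y-x {d} d∈D = x∈p∧x≢y⇒x∈p-y (D⊆Y d∈D) λ { refl → x∉D d∈D }

  circuit-through : e ∈ Y → r M Y ≤ r M (Y - e) → ∃ λ C → IsCircuit M C × C ⊆ Y × e ∈ C
  circuit-through {e} {Y} = go Y (⊂-wellFounded Y)
    -- Shrink Y while e stays spanned by the rest; when no element can be dropped, Y is a circuit.
    where
    go : ∀ Y → Acc _⊂_ Y → e ∈ Y → r M Y ≤ r M (Y - e) → ∃ λ C → IsCircuit M C × C ⊆ Y × e ∈ C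
    go Y (acc rs) e∈Y e∈clY-e
      with any? (λ f → f ∈? Y ×-dec ¬? (f ≟ e) ×-dec (r M (Y - f) ≤? r M (Y - f - e)))
    ... | yes (f , f∈Y , f≢e , e∈clY-f-e)
        with go (Y - f) (rs (x∈p⇒p-x⊂p f∈Y)) (x∈p∧x≢y⇒x∈p-y e∈Y (f≢e ∘ sym)) e∈clY-f-e
    ...   | C , circuit , C⊆Y-f , e∈C = C , circuit , p─q⊆p Y ⁅ f ⁆ ∘ C⊆Y-f , e∈C
    go Y (acc rs) e∈Y e∈clY-e | no ∄f =
      Y , minimal-nonColoop⇒circuit e∈Y e∈clY-e minimal , id , e∈Y
      where
      minimal : ∀ {f} → f ∈ Y → f ≢ e → r M (Y - f - e) < r M (Y - f)
      minimal {f} f∈Y f≢e = ≰⇒> λ e∈clY-f-e → ∄f (f , f∈Y , f≢e , e∈clY-f-e)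

  noColoops⇒unionOfCircuits : NoColoops M X → IsUnionOfCircuits M X
  noColoops⇒unionOfCircuits noColoops e e∈X = circuit-through e∈X (noColoops e∈X)

  noColoops-⊆ : NoColoops M X → r M G + ∣ X ─ G ∣ ≤ r M X → X ⊆ G
  noColoops-⊆ {X} {G} noColoops bound {e} e∈X with e ∈? G
  ... | yes e∈G = e∈G
  ... | no  e∉G = contradiction (begin-strict
    r M X                          ≤⟨ noColoops e∈X ⟩
    r M (X - e)                    ≤⟨ r[X]≤r[Y]+∣X─Y∣ (X - e) G ⟩
    r M G + ∣ X - e ─ G ∣          <⟨ +-monoʳ-< (r M G) (≤-reflexive (sym (x∈p∧x∉q⇒∣p─q∣≡1+∣p-x─q∣ e∈X e∉G))) ⟩
    r M G + ∣ X ─ G ∣              ≤⟨ bound ⟩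
    r M X                          ∎) (<-irrefl refl)
    where open ≤-Reasoning

  flatHull : ∀ X → ∃ λ F → IsFlat M F × X ⊆ F × r M F ≤ r M X
  flatHull X = go X (⊃-wellFounded X)
    where
    go : ∀ X → Acc _⊃_ X → ∃ λ F → IsFlat M F × X ⊆ F × r M F ≤ r M X
    go X (acc rs) with any? (λ e → ¬? (e ∈? X) ×-dec (r M (X ∪ ⁅ e ⁆) ≤? r M X))
    ... | yes (e , e∉X , e∈clX) with go (X ∪ ⁅ e ⁆) (rs (p⊆p∪q ⁅ e ⁆ , e , q⊆p∪q X ⁅ e ⁆ (x∈⁅x⁆ e) , e∉X))
    ...   | F , flat , X∪⁅e⁆⊆F , rF≤ = F , flat , X∪⁅e⁆⊆F ∘ p⊆p∪q ⁅ e ⁆ , ≤-trans rF≤ e∈clX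
    go X (acc rs) | no ∄e = X , flat , id , ≤-refl
      where
      flat : IsFlat M X
      flat e e∉X = ≰⇒> λ e∈clX → ∄e (e , e∉X , e∈clX)

  noColoopsPart : ∀ X → ∃ λ Y → Y ⊆ X × NoColoops M Y × r M Y + ∣ X ─ Y ∣ ≤ r M X
  noColoopsPart X = go X (⊂-wellFounded X)
    where
    go : ∀ X → Acc _⊂_ X → ∃ λ Y → Y ⊆ X × NoColoops M Y × r M Y + ∣ X ─ Y ∣ ≤ r M X
    go X (acc rs) with any? (λ e → e ∈? X ×-dec (suc (r M (X - e)) ≤? r M X))
    ... | yes (e , e∈X , coloop) with go (X - e) (rs (x∈p⇒p-x⊂p e∈X))
    ...   | Y , Y⊆X-e , noColoops , bound = Y , p─q⊆p X ⁅ e ⁆ ∘ Y⊆X-e , noColoops , (begin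
      r M Y + ∣ X ─ Y ∣              ≡⟨ cong (r M Y +_) (x∈p∧x∉q⇒∣p─q∣≡1+∣p-x─q∣ e∈X e∉Y) ⟩
      r M Y + suc ∣ X - e ─ Y ∣      ≡⟨ +-suc (r M Y) _ ⟩
      suc (r M Y + ∣ X - e ─ Y ∣)    ≤⟨ s≤s bound ⟩
      suc (r M (X - e))              ≤⟨ coloop ⟩
      r M X                          ∎)
      where
      open ≤-Reasoning
      e∉Y : e ∉ Y
      e∉Y e∈Y = x∈p-y⇒x≢y (Y⊆X-e e∈Y) refl
    go X (acc rs) | no ∄e = X , id , noColoops , ≤-reflexive (trans (cong (r M X +_) (∣p─p∣≡0 X)) (+-identityʳ _))
      where
      noColoops : NoColoops M X
      noColoops e∈X = ≮⇒≥ λ coloop → ∄e (_ , e∈X , coloop)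

  noColoops-hull : NoColoops M Y → Y ⊆ F → r M F ≤ r M Y → NoColoops M F
  noColoops-hull {Y} {F} noColoops Y⊆F rF≤rY {e} e∈F = begin
    r M F          ≤⟨ rF≤rY ⟩
    r M Y          ≤⟨ rY≤rY-e ⟩
    r M (Y - e)    ≤⟨ r-mono M (─-monoˡ-⊆ Y⊆F) ⟩
    r M (F - e)    ∎
    where
    open ≤-Reasoning
    rY≤rY-e : r M Y ≤ r M (Y - e)
    rY≤rY-e with e ∈? Y
    ... | yes e∈Y = noColoops e∈Y
    ... | no  e∉Y = r-mono M λ x∈Y → x∈p∧x≢y⇒x∈p-y x∈Y λ { refl → e∉Y x∈Y }

  cyclicCore : ∀ X → CyclicCore M X
  cyclicCore X with noColoopsPart X
  ... | Y , Y⊆X , noColoopsY , boundY with flatHull Y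
  ...   | F , flat , Y⊆F , rF≤rY = record
    { core         = F
    ; isCyclicFlat = flat , noColoops⇒unionOfCircuits (noColoops-hull noColoopsY Y⊆F rF≤rY)
    ; rank-bound   = ≤-trans (+-mono-≤ rF≤rY (p⊆q⇒∣p∣≤∣q∣ (─-antimonoʳ-⊆ {p = X} Y⊆F))) boundY
    ; spanned      = ⊆cl-monoʳ Y⊆X (≤-trans (r-mono M Y∪F⊆F) rF≤rY)
    }
    where
    Y∪F⊆F : Y ∪ F ⊆ F
    Y∪F⊆F x∈ = [ Y⊆F , id ] (x∈p∪q⁻ Y F x∈)

  core-of-cyclicFlat : IsCyclicFlat M F → (c : CyclicCore M F) → core c ≡ F
  core-of-cyclicFlat (flat , unionOfCircuits) c =
    ⊆-antisym (flat-⊆cl⇒⊆ flat (spanned c)) (noColoops-⊆ (unionOfCircuits⇒noColoops unionOfCircuits) (rank-bound c))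

  -- Every cyclic flat is its own cyclic core, so this lists all of them (with repetitions).
  cyclicFlats : Vec (Subset n) (2 ^ n)
  cyclicFlats = map (core ∘ cyclicCore) (allSubsets n)

  cyclicFlats-cyclic : All (IsCyclicFlat M) cyclicFlats
  cyclicFlats-cyclic = map⁺ (All.universal (isCyclicFlat ∘ cyclicCore) (allSubsets n))

  cyclicFlat∈cyclicFlats : IsCyclicFlat M F → F ∈ᵥ cyclicFlats
  cyclicFlat∈cyclicFlats {F} cyclicF =
    subst (_∈ᵥ cyclicFlats) (core-of-cyclicFlat cyclicF (cyclicCore F)) (∈-map⁺ (core ∘ cyclicCore) (∈-allSubsets F))

rank-determined-by-cyclicFlats :
  (M N : Matroid n) (σ : Permutation′ n) →
  (∀ F → IsCyclicFlat M F → r N (image σ F) ≡ r M F) →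
  (∀ G → IsCyclicFlat N G → ∃ λ F → IsCyclicFlat M F × image σ F ≡ G) →
  ∀ X → r N (image σ X) ≡ r M X
rank-determined-by-cyclicFlats M N σ rank-preserved onto X = ≤-antisym rN≤rM rM≤rN
  where
  open ≤-Reasoning

  ∣image─image∣ : ∀ F → ∣ image σ X ─ image σ F ∣ ≡ ∣ X ─ F ∣
  ∣image─image∣ F = trans (cong ∣_∣ (sym (image-─ σ X F))) (∣image∣≡∣p∣ σ (X ─ F))

  rN≤rM : r N (image σ X) ≤ r M X
  rN≤rM = begin
    r N (image σ X)                              ≤⟨ r[X]≤r[Y]+∣X─Y∣ N (image σ X) (image σ F) ⟩
    r N (image σ F) + ∣ image σ X ─ image σ F ∣  ≡⟨ cong₂ _+_ (rank-preserved F (isCyclicFlat c)) (∣image─image∣ F) ⟩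
    r M F + ∣ X ─ F ∣                            ≤⟨ rank-bound c ⟩
    r M X                                        ∎
    where
    c = cyclicCore M X
    F = core c

  rM≤rN : r M X ≤ r N (image σ X)
  rM≤rN = via (onto G (isCyclicFlat c))
    where
    c = cyclicCore N (image σ X)
    G = core c
    via : (∃ λ F → IsCyclicFlat M F × image σ F ≡ G) → r M X ≤ r N (image σ X)
    via (F , cyclicF , σF≡G) = begin
      r M X                                        ≤⟨ r[X]≤r[Y]+∣X─Y∣ M X F ⟩
      r M F + ∣ X ─ F ∣                            ≡⟨ cong₂ _+_ (rank-preserved F cyclicF) (∣image─image∣ F) ⟨
      r N (image σ F) + ∣ image σ X ─ image σ F ∣  ≡⟨ cong (λ H → r N H + ∣ image σ X ─ H ∣) σF≡G ⟩
      r N G + ∣ image σ X ─ G ∣                    ≤⟨ rank-bound c ⟩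
      r N (image σ X)                              ∎

-- Configuration isomorphisms

module ConfigurationIso {n : ℕ} {M N : Matroid n} {Φ : Subset n → Subset n} (iso : IsConfigurationIso M N Φ) where

  open IsConfigurationIso iso

  private
    module ℕ+ = CommutativeSemigroupProperties +-commutativeSemigroup
    module ∩ = CommutativeSemigroupProperties (CommutativeMonoid.commutativeSemigroup (∩-commutativeMonoid n))

  private
    variable
      A B : Subset n

  r[A∪B]≤r[ΦA∪ΦB] : IsCyclicFlat M A → IsCyclicFlat M B → IsCyclicFlat M (A ∪ B) → r M (A ∪ B) ≤ r N (Φ A ∪ Φ B)
  r[A∪B]≤r[ΦA∪ΦB] {A} {B} cyclicA cyclicB cyclicA∪B = via (onto G (isCyclicFlat c))
    where
    X = Φ A ∪ Φ B
    c = cyclicCore N X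
    G = core c
    X⊆G : X ⊆ G
    X⊆G = noColoops-⊆ N (unionOfCircuits⇒noColoops N unionOfCircuits) (rank-bound c)
      where
      unionOfCircuits : IsUnionOfCircuits N X
      unionOfCircuits = ∪-unionOfCircuits N (proj₂ (maps-to A cyclicA)) (proj₂ (maps-to B cyclicB))
    via : (∃ λ D → IsCyclicFlat M D × Φ D ≡ G) → r M (A ∪ B) ≤ r N X
    via (D , cyclicD , ΦD≡G) = begin
      r M (A ∪ B)          ≡⟨ rank (A ∪ B) cyclicA∪B ⟨
      r N (Φ (A ∪ B))      ≤⟨ r-mono N (monotone (A ∪ B) D cyclicA∪B cyclicD A∪B⊆D) ⟩
      r N (Φ D)            ≡⟨ cong (r N) ΦD≡G ⟩
      r N G                ≤⟨ m≤m+n (r N G) ∣ X ─ G ∣ ⟩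
      r N G + ∣ X ─ G ∣    ≤⟨ rank-bound c ⟩
      r N X                ∎
      where
      open ≤-Reasoning
      ⊆D : ∀ {F} → IsCyclicFlat M F → Φ F ⊆ X → F ⊆ D
      ⊆D {F} cyclicF ΦF⊆X = reflects F D cyclicF cyclicD (subst (Φ F ⊆_) (sym ΦD≡G) (X⊆G ∘ ΦF⊆X))
      A∪B⊆D : A ∪ B ⊆ D
      A∪B⊆D x∈ = [ ⊆D cyclicA (p⊆p∪q (Φ B)) , ⊆D cyclicB (q⊆p∪q (Φ A) (Φ B)) ] (x∈p∪q⁻ A B x∈)

  ∣ΦA∩ΦB∣≤∣A∩B∣ : IsCyclicFlat M A → IsCyclicFlat M B → IsCyclicFlat M (A ∪ B) → ModularPair M A B →
              ∣ Φ A ∩ Φ B ∣ ≤ ∣ A ∩ B ∣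
  ∣ΦA∩ΦB∣≤∣A∩B∣ {A} {B} cyclicA cyclicB cyclicA∪B modular = via (onto G (isCyclicFlat c))
    where
    open ≤-Reasoning
    I = Φ A ∩ Φ B
    c = cyclicCore N I
    G = core c

    G⊆Φ : ∀ {F} → IsCyclicFlat M F → I ⊆ Φ F → G ⊆ Φ F
    G⊆Φ {F} cyclicF I⊆ΦF = flat-⊆cl⇒⊆ N (proj₁ (maps-to F cyclicF)) (⊆cl-monoʳ N I⊆ΦF (spanned c))

    G⊆I : G ⊆ I
    G⊆I x∈G = x∈p∩q⁺ (G⊆Φ cyclicA (p∩q⊆p (Φ A) (Φ B)) x∈G , G⊆Φ cyclicB (p∩q⊆q (Φ A) (Φ B)) x∈G)

    rI≤r∩ : r N I ≤ r M (A ∩ B)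
    rI≤r∩ = +-cancelˡ-≤ (r M (A ∪ B)) _ _ (begin
      r M (A ∪ B) + r N I          ≤⟨ +-monoˡ-≤ (r N I) (r[A∪B]≤r[ΦA∪ΦB] cyclicA cyclicB cyclicA∪B) ⟩
      r N (Φ A ∪ Φ B) + r N I      ≤⟨ r-submod N (Φ A) (Φ B) ⟩
      r N (Φ A) + r N (Φ B)        ≡⟨ cong₂ _+_ (rank A cyclicA) (rank B cyclicB) ⟩
      r M A + r M B                ≡⟨ modular ⟩
      r M (A ∪ B) + r M (A ∩ B)    ∎)

    via : (∃ λ D → IsCyclicFlat M D × Φ D ≡ G) → ∣ I ∣ ≤ ∣ A ∩ B ∣
    via (D , cyclicD , ΦD≡G) = +-cancelˡ-≤ (r M D) _ _ (begin
      r M D + ∣ I ∣                          ≡⟨ cong₂ _+_ rG≡rD (q⊆p⇒∣q∣+∣p─q∣≡∣p∣ G⊆I) ⟨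
      r N G + (∣ G ∣ + ∣ I ─ G ∣)            ≡⟨ ℕ+.x∙yz≈y∙xz (r N G) ∣ G ∣ _ ⟩
      ∣ G ∣ + (r N G + ∣ I ─ G ∣)            ≤⟨ +-monoʳ-≤ ∣ G ∣ bound ⟩
      ∣ G ∣ + (r M D + ∣ A ∩ B ─ D ∣)        ≡⟨ cong (_+ (r M D + ∣ A ∩ B ─ D ∣)) ∣G∣≡∣D∣ ⟩
      ∣ D ∣ + (r M D + ∣ A ∩ B ─ D ∣)        ≡⟨ ℕ+.x∙yz≈y∙xz ∣ D ∣ (r M D) _ ⟩
      r M D + (∣ D ∣ + ∣ A ∩ B ─ D ∣)        ≡⟨ cong (r M D +_) (q⊆p⇒∣q∣+∣p─q∣≡∣p∣ D⊆A∩B) ⟩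
      r M D + ∣ A ∩ B ∣                      ∎)
      where
      bound : r N G + ∣ I ─ G ∣ ≤ r M D + ∣ A ∩ B ─ D ∣
      bound = ≤-trans (rank-bound c) (≤-trans rI≤r∩ (r[X]≤r[Y]+∣X─Y∣ M (A ∩ B) D))
      rG≡rD : r N G ≡ r M D
      rG≡rD = trans (cong (r N) (sym ΦD≡G)) (rank D cyclicD)
      ∣G∣≡∣D∣ : ∣ G ∣ ≡ ∣ D ∣
      ∣G∣≡∣D∣ = trans (cong ∣_∣ (sym ΦD≡G)) (size D cyclicD)
      D⊆ : ∀ {F} → IsCyclicFlat M F → G ⊆ Φ F → D ⊆ F
      D⊆ {F} cyclicF G⊆ΦF = reflects D F cyclicD cyclicF (subst (_⊆ Φ F) (sym ΦD≡G) G⊆ΦF)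
      D⊆A∩B : D ⊆ A ∩ B
      D⊆A∩B x∈D = x∈p∩q⁺ (D⊆ cyclicA (p∩q⊆p (Φ A) (Φ B) ∘ G⊆I) x∈D , D⊆ cyclicB (p∩q⊆q (Φ A) (Φ B) ∘ G⊆I) x∈D)

  Φ-∪ : IsCyclicFlat M A → IsCyclicFlat M B → IsCyclicFlat M (A ∪ B) → ModularPair M A B →
        Φ (A ∪ B) ≡ Φ A ∪ Φ B
  Φ-∪ {A} {B} cyclicA cyclicB cyclicA∪B modular =
    sym (p⊆q⇒∣q∣≤∣p∣⇒p≡q Φ∪Φ⊆Φ∪ (+-cancelʳ-≤ ∣ Φ A ∩ Φ B ∣ _ _ (begin
      ∣ Φ (A ∪ B) ∣ + ∣ Φ A ∩ Φ B ∣    ≤⟨ +-mono-≤ (≤-reflexive (size (A ∪ B) cyclicA∪B))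
                                                   (∣ΦA∩ΦB∣≤∣A∩B∣ cyclicA cyclicB cyclicA∪B modular) ⟩
      ∣ A ∪ B ∣ + ∣ A ∩ B ∣            ≡⟨ ∣p∪q∣+∣p∩q∣≡∣p∣+∣q∣ A B ⟩
      ∣ A ∣ + ∣ B ∣                    ≡⟨ cong₂ _+_ (size A cyclicA) (size B cyclicB) ⟨
      ∣ Φ A ∣ + ∣ Φ B ∣                ≡⟨ ∣p∪q∣+∣p∩q∣≡∣p∣+∣q∣ (Φ A) (Φ B) ⟨
      ∣ Φ A ∪ Φ B ∣ + ∣ Φ A ∩ Φ B ∣    ∎)))
    where
    open ≤-Reasoning
    Φ∪Φ⊆Φ∪ : Φ A ∪ Φ B ⊆ Φ (A ∪ B)
    Φ∪Φ⊆Φ∪ x∈ = [ monotone A (A ∪ B) cyclicA cyclicA∪B (p⊆p∪q B)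
                 , monotone B (A ∪ B) cyclicB cyclicA∪B (q⊆p∪q A B) ] (x∈p∪q⁻ (Φ A) (Φ B) x∈)

  induced⇒rank-preserving : (σ : Permutation′ n) → (∀ F → IsCyclicFlat M F → Φ F ≡ image σ F) →
                            ∀ X → r N (image σ X) ≡ r M X
  induced⇒rank-preserving σ Φ≡image = rank-determined-by-cyclicFlats M N σ rank-preserved onto′
    where
    rank-preserved : ∀ F → IsCyclicFlat M F → r N (image σ F) ≡ r M F
    rank-preserved F cyclicF = trans (cong (r N) (sym (Φ≡image F cyclicF))) (rank F cyclicF)

    onto′ : ∀ G → IsCyclicFlat N G → ∃ λ F → IsCyclicFlat M F × image σ F ≡ G
    onto′ G cyclicG =
      let F , cyclicF , ΦF≡G = onto G cyclicG
      in  F , cyclicF , trans (sym (Φ≡image F cyclicF)) ΦF≡G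

  module _ (unionClosedModular : ∀ A B → IsCyclicFlat M A → IsCyclicFlat M B →
                                   ModularPair M A B × IsCyclicFlat M (A ∪ B)) where

    cyclicFlat-∪ : IsCyclicFlat M A → IsCyclicFlat M B → IsCyclicFlat M (A ∪ B)
    cyclicFlat-∪ {A} {B} cyclicA cyclicB = proj₂ (unionClosedModular A B cyclicA cyclicB)

    Φ-preserves-∪ : IsCyclicFlat M A → IsCyclicFlat M B → Φ (A ∪ B) ≡ Φ A ∪ Φ B
    Φ-preserves-∪ {A} {B} cyclicA cyclicB =
      Φ-∪ cyclicA cyclicB (cyclicFlat-∪ cyclicA cyclicB) (proj₁ (unionClosedModular A B cyclicA cyclicB))

    Φ-map-∪ : ∀ {C} {Fs : Vec (Subset n) k} → IsCyclicFlat M C → All (IsCyclicFlat M) Fs →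
              map Φ (map (C ∪_) Fs) ≡ map (Φ C ∪_) (map Φ Fs)
    Φ-map-∪ cyclicC []                  = refl
    Φ-map-∪ cyclicC (cyclicF ∷ cyclicFs) = cong₂ _∷_ (Φ-preserves-∪ cyclicC cyclicF) (Φ-map-∪ cyclicC cyclicFs)

    ∣⋂∣-preserved : (Fs : Vec (Subset n) k) → All (IsCyclicFlat M) Fs → ∣ ⋂ (toList Fs) ∣ ≡ ∣ ⋂ (toList (map Φ Fs)) ∣
    ∣⋂∣-preserved []       []                    = refl
    ∣⋂∣-preserved (C ∷ Fs) (cyclicC ∷ cyclicFs) =
      ∣∩∣-determined {p = C} {⋂ (toList Fs)} {Φ C} {⋂ (toList (map Φ Fs))}
        (sym (size C cyclicC)) (∣⋂∣-preserved Fs cyclicFs) (begin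
        ∣ C ∪ ⋂ (toList Fs) ∣                        ≡⟨ cong ∣_∣ (p∪⋂qs≡⋂[p∪qs] C Fs) ⟩
        ∣ ⋂ (toList (map (C ∪_) Fs)) ∣
          ≡⟨ ∣⋂∣-preserved (map (C ∪_) Fs) (map⁺ (All.map (cyclicFlat-∪ cyclicC) cyclicFs)) ⟩
        ∣ ⋂ (toList (map Φ (map (C ∪_) Fs))) ∣       ≡⟨ cong (∣_∣ ∘ ⋂ ∘ toList) (Φ-map-∪ cyclicC cyclicFs) ⟩
        ∣ ⋂ (toList (map (Φ C ∪_) (map Φ Fs))) ∣     ≡⟨ cong ∣_∣ (p∪⋂qs≡⋂[p∪qs] (Φ C) (map Φ Fs)) ⟨
        ∣ Φ C ∪ ⋂ (toList (map Φ Fs)) ∣             ∎)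
      where open ≡-Reasoning

    -- Gs collects the positive literals already processed; complemented literals are removed
    -- by inclusion–exclusion.
    ∣⋂∩atom∣-preserved : (Fs : Vec (Subset n) k) (Gs : Vec (Subset n) m) →
                         All (IsCyclicFlat M) Fs → All (IsCyclicFlat M) Gs → ∀ τ →
                         ∣ ⋂ (toList Gs) ∩ atom Fs τ ∣ ≡ ∣ ⋂ (toList (map Φ Gs)) ∩ atom (map Φ Fs) τ ∣
    ∣⋂∩atom∣-preserved [] Gs [] cyclicGs [] = begin
      ∣ ⋂ (toList Gs) ∩ ⊤ ∣                ≡⟨ cong ∣_∣ (∩-identityʳ (⋂ (toList Gs))) ⟩
      ∣ ⋂ (toList Gs) ∣                    ≡⟨ ∣⋂∣-preserved Gs cyclicGs ⟩
      ∣ ⋂ (toList (map Φ Gs)) ∣            ≡⟨ cong ∣_∣ (∩-identityʳ (⋂ (toList (map Φ Gs)))) ⟨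
      ∣ ⋂ (toList (map Φ Gs)) ∩ ⊤ ∣        ∎
      where open ≡-Reasoning
    ∣⋂∩atom∣-preserved (F ∷ Fs) Gs (cyclicF ∷ cyclicFs) cyclicGs (s ∷ τ) = preserved s
      where
      open ≡-Reasoning
      X  = ⋂ (toList Gs)
      X′ = ⋂ (toList (map Φ Gs))
      T  = atom Fs τ
      T′ = atom (map Φ Fs) τ

      with-F : ∣ X ∩ (F ∩ T) ∣ ≡ ∣ X′ ∩ (Φ F ∩ T′) ∣
      with-F = begin
        ∣ X ∩ (F ∩ T) ∣          ≡⟨ cong ∣_∣ (∩.x∙yz≈yx∙z X F T) ⟩
        ∣ (F ∩ X) ∩ T ∣          ≡⟨ ∣⋂∩atom∣-preserved Fs (F ∷ Gs) cyclicFs (cyclicF ∷ cyclicGs) τ ⟩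
        ∣ (Φ F ∩ X′) ∩ T′ ∣      ≡⟨ cong ∣_∣ (∩.x∙yz≈yx∙z X′ (Φ F) T′) ⟨
        ∣ X′ ∩ (Φ F ∩ T′) ∣      ∎

      split : ∀ (Y G U : Subset n) → ∣ Y ∩ (G ∩ U) ∣ + ∣ Y ∩ (∁ G ∩ U) ∣ ≡ ∣ Y ∩ U ∣
      split Y G U = begin
        ∣ Y ∩ (G ∩ U) ∣ + ∣ Y ∩ (∁ G ∩ U) ∣
          ≡⟨ cong₂ (λ a b → ∣ a ∣ + ∣ b ∣) (∩.x∙yz≈xz∙y Y G U) (∩.x∙yz≈xz∙y Y (∁ G) U) ⟩
        ∣ (Y ∩ U) ∩ G ∣ + ∣ (Y ∩ U) ∩ ∁ G ∣        ≡⟨ ∣p∩q∣+∣p∩∁q∣≡∣p∣ (Y ∩ U) G ⟩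
        ∣ Y ∩ U ∣                                  ∎

      preserved : ∀ s → ∣ X ∩ atom (F ∷ Fs) (s ∷ τ) ∣ ≡ ∣ X′ ∩ atom (map Φ (F ∷ Fs)) (s ∷ τ) ∣
      preserved inside  = with-F
      preserved outside = +-cancelˡ-≡ ∣ X ∩ (F ∩ T) ∣ _ _ (begin
        ∣ X ∩ (F ∩ T) ∣ + ∣ X ∩ (∁ F ∩ T) ∣           ≡⟨ split X F T ⟩
        ∣ X ∩ T ∣                                     ≡⟨ ∣⋂∩atom∣-preserved Fs Gs cyclicFs cyclicGs τ ⟩
        ∣ X′ ∩ T′ ∣                                   ≡⟨ split X′ (Φ F) T′ ⟨
        ∣ X′ ∩ (Φ F ∩ T′) ∣ + ∣ X′ ∩ (∁ (Φ F) ∩ T′) ∣ ≡⟨ cong (_+ ∣ X′ ∩ (∁ (Φ F) ∩ T′) ∣) with-F ⟨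
        ∣ X ∩ (F ∩ T) ∣ + ∣ X′ ∩ (∁ (Φ F) ∩ T′) ∣     ∎)

    ∣atom∣-preserved : (Fs : Vec (Subset n) k) → All (IsCyclicFlat M) Fs → ∀ τ → ∣ atom Fs τ ∣ ≡ ∣ atom (map Φ Fs) τ ∣
    ∣atom∣-preserved Fs cyclicFs τ = begin
      ∣ atom Fs τ ∣              ≡⟨ cong ∣_∣ (∩-identityˡ (atom Fs τ)) ⟨
      ∣ ⊤ ∩ atom Fs τ ∣          ≡⟨ ∣⋂∩atom∣-preserved Fs [] cyclicFs [] τ ⟩
      ∣ ⊤ ∩ atom (map Φ Fs) τ ∣  ≡⟨ cong ∣_∣ (∩-identityˡ (atom (map Φ Fs) τ)) ⟩
      ∣ atom (map Φ Fs) τ ∣      ∎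
      where open ≡-Reasoning

    inducing-permutation : Σ (Permutation′ n) λ σ → ∀ F → IsCyclicFlat M F → Φ F ≡ image σ F
    inducing-permutation = flip π , Φ≡image
      where
      open ≡-Reasoning
      Fs = cyclicFlats M

      same-fibres : ∀ τ → ∣ fibre _≟ˢ_ (profile (map Φ Fs)) τ ∣ ≡ ∣ fibre _≟ˢ_ (profile Fs) τ ∣
      same-fibres τ = begin
        ∣ fibre _≟ˢ_ (profile (map Φ Fs)) τ ∣   ≡⟨ cong ∣_∣ (atom≡fibre (map Φ Fs) τ) ⟨
        ∣ atom (map Φ Fs) τ ∣                   ≡⟨ ∣atom∣-preserved Fs (cyclicFlats-cyclic M) τ ⟨
        ∣ atom Fs τ ∣                           ≡⟨ cong ∣_∣ (atom≡fibre Fs τ) ⟩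
        ∣ fibre _≟ˢ_ (profile Fs) τ ∣           ∎

      matching : Σ (Permutation′ n) λ π → ∀ j → profile Fs (π ⟨$⟩ʳ j) ≡ profile (map Φ Fs) j
      matching = equinumerous-fibres⇒permutation _≟ˢ_ (profile (map Φ Fs)) (profile Fs) same-fibres
      π = proj₁ matching

      Φ≡image : ∀ F → IsCyclicFlat M F → Φ F ≡ image (flip π) F
      Φ≡image F cyclicF = trans (sym (tabulate∘lookup (Φ F))) (tabulate-cong pointwise)
        where
        pointwise : ∀ j → lookup (Φ F) j ≡ lookup F (π ⟨$⟩ʳ j)
        pointwise j = sym (map-cong⁻ (trans (proj₂ matching j) (sym (map-∘ (λ G → lookup G j) Φ Fs)))
                                     (cyclicFlat∈cyclicFlats M cyclicF))

corollary6p2 : (n : ℕ) (M : Matroid n) →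
    (∀ A B → IsCyclicFlat M A → IsCyclicFlat M B →
      ModularPair M A B × IsCyclicFlat M (A ∪ B)) →
    ConfigurationUnique M
corollary6p2 n M unionClosedModular N (Φ , iso) =
  let σ , Φ≡image = inducing-permutation unionClosedModular
  in  σ , induced⇒rank-preserving σ Φ≡image
  where open ConfigurationIso iso
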